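{- Let $n\ge 2$, $1\le k<n$, $S_n=\{1,\dots,n\}$, and let $\mathbb{K}^k_n=(S_n\cup\{g_1\},S_n\cup\{m_1,m_2\},I)$ where $g_1,m_1,m_2$ are new elements and $gIm$ holds iff either $g,m\in S_n$ and $g\ne m$; or $g=g_1$ and $m\in S_n$; or $g\in\{1,\dots,k\}$ and $m=m_1$; or $g\in S_n\setminus\{1,\dots,k\}$ and $m=m_2$. Let $\mathbb{K}^k_{n\mathrm{ge}}=(S_n\cup\{g_1\},S_n\cup\{m_{12}\},J)$, where $J$ agrees with $I$ on attributes in $S_n$ and $g\,J\,m_{12}$ iff $g\,I\,m_1$ or $g\,I\,m_2$. Then: (a) $\mathbb{K}^k_n$ has exactly $2^n+2^{n-k}+2^k-1$ concepts; (b) $|\mathfrak{B}(\mathbb{K}^k_{n\mathrm{ge}})|-|\mathfrak{B}(\mathbb{K}^k_n)|=2^n-2^k-2^{n-k}+1$.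
   Context: A formal context $(G,M,I)$ has objects $G$, attributes $M$, incidence $I\subseteq G\times M$. A formal concept is a pair $(A,B)$, $A\subseteq G$, $B\subseteq M$, such that $B$ is exactly the set of attributes shared by all objects of $A$ and $A$ is exactly the set of objects having all attributes of $B$. $\mathfrak{B}(\mathbb{K})$ is the set of concepts of $\mathbb{K}$. -}

module Defs where

open import Data.Nat using (ℕ; zero; suc; _+_; _<ᵇ_)
open import Data.Bool using (Bool; true; false; _∧_; _∨_; not; if_then_else_)
open import Data.Fin using (Fin; zero; suc; toℕ; splitAt)
open import Data.Fin.Subset using (Subset)
open import Data.Vec using (Vec; lookup; tabulate)
open import Data.Sum using (_⊎_; inj₁; inj₂)
open import Data.Product using (Σ; _×_; _,_)
open import Relation.Binary.PropositionalEquality using (_≡_)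
open import Relation.Nullary.Decidable using (⌊_⌋)
import Data.Fin as F

record Context : Set where
  field
    nG  : ℕ
    nM  : ℕ
    inc : Fin nG → Fin nM → Bool

allᵇ : ∀ {n} → (Fin n → Bool) → Bool
allᵇ {zero}  p = true
allᵇ {suc n} p = p zero ∧ allᵇ (λ i → p (suc i))

_⇒ᵇ_ : Bool → Bool → Bool
a ⇒ᵇ b = not a ∨ b

module _ (K : Context) where
  open Context K

  intent : Subset nG → Subset nM
  intent A = tabulate λ m → allᵇ (λ g → lookup A g ⇒ᵇ inc g m)

  extent : Subset nM → Subset nG
  extent B = tabulate λ g → allᵇ (λ m → lookup B m ⇒ᵇ inc g m)

  Concept : Set
  Concept = Σ (Subset nG × Subset nM) λ where
    (A , B) → (intent A ≡ B) × (extent B ≡ A)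

-- Objects  S_n ∪ {g₁}       = Fin (n + 1):  splitAt n gives inj₁ i for the
--                             element i+1 ∈ S_n (i : Fin n), inj₂ zero for g₁.
-- Attributes of K^k_n  S_n ∪ {m₁, m₂} = Fin (n + 2): inj₁ i is i+1 ∈ S_n,
--                             inj₂ zero is m₁, inj₂ (suc zero) is m₂.
-- Attributes of K^k_nge  S_n ∪ {m₁₂} = Fin (n + 1): inj₂ zero is m₁₂.

-- i : Fin n represents element i+1; it lies in {1,…,k} iff i+1 ≤ k iff i < k.
inLow : ∀ {n} → ℕ → Fin n → Bool
inLow k i = toℕ i <ᵇ k

neq : ∀ {n} → Fin n → Fin n → Bool
neq i j = not ⌊ i F.≟ j ⌋

I-rel : (n k : ℕ) → Fin (n + 1) → Fin (n + 2) → Bool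
I-rel n k g m with splitAt n g | splitAt n m
... | inj₁ i | inj₁ j              = neq i j
... | inj₂ _ | inj₁ j              = true
... | inj₂ _ | inj₂ _              = false
... | inj₁ i | inj₂ zero           = inLow k i
... | inj₁ i | inj₂ (suc zero)     = not (inLow k i)

K : (n k : ℕ) → Context
K n k = record { nG = n + 1 ; nM = n + 2 ; inc = I-rel n k }

J-rel : (n k : ℕ) → Fin (n + 1) → Fin (n + 1) → Bool
J-rel n k g m with splitAt n m
... | inj₁ j = I-rel n k g ((j F.↑ˡ 2))
... | inj₂ _ = I-rel n k g ((n F.↑ʳ zero)) ∨ I-rel n k g ((n F.↑ʳ suc zero))

Kge : (n k : ℕ) → Context
Kge n k = record { nG = n + 1 ; nM = n + 1 ; inc = J-rel n k }

module Submission where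

-- Concepts of a finite context are in bijection with its closed sets of
-- objects, i.e. the sets A with A'' = A.  Every set A of objects not
-- containing the object i ∈ S_n is separated from i by the attribute i, so
-- in both contexts closedness is only a question about g₁:
--   * in K^k_n, a set A with g₁ ∉ A is closed iff m₁ or m₂ lies in A', i.e.
--     iff A ⊆ {1,…,k} or A ⊆ S_n ∖ {1,…,k};
--   * in K^k_nge every set is closed, because m₁₂ is shared by all of S_n.
-- Counting the closed sets of K^k_n by the value at g₁ gives
--   2^n  +  #{T ⊆ S_n | T ⊆ L or T ⊆ ∁L}  =  2^n + (2^k + 2^(n-k) - 2^|L ∩ ∁L|),
-- by inclusion–exclusion and the fact that a set P has 2^|P| subsets.

open import Defs
open import Data.Nat using (ℕ; _≤_; _<_; _^_; _+_; _∸_)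
open import Data.Integer using (ℤ; +_) renaming (_+_ to _+ℤ_; _-_ to _-ℤ_)
open import Data.Fin using (Fin)
open import Data.Product using (_×_)
open import Function.Bundles using (_↔_)
open import Relation.Binary.PropositionalEquality using (_≡_)

open import Data.Nat using (zero; suc; z≤n; s≤s)
import Data.Nat.Properties as ℕP
open import Data.Nat.Solver using (module +-*-Solver)
open import Data.Integer.Properties using (pos-+)
import Data.Integer.Solver as ℤSolver
open import Data.Bool using (Bool; true; false; _∧_; _∨_; not; if_then_else_)
import Data.Bool.Properties as BoolP
open import Data.Fin using (zero; suc; _↑ˡ_; _↑ʳ_; splitAt; join)
import Data.Fin as Fin
import Data.Fin.Properties as FinP
open import Data.Fin.Subset using (Subset; ∣_∣; _∩_; ∁)
open import Data.Fin.Subset.Properties using (∣∁p∣≡n∸∣p∣; ∩-inverseʳ; ∣⊥∣≡0)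
open import Data.Fin.Permutation using (↔⇒≡)
open import Data.Vec using ([]; _∷_; lookup; tabulate; _++_)
import Data.Vec.Properties as VecP
open import Data.Sum using (_⊎_; inj₁; inj₂)
open import Data.Sum.Function.Propositional using (_⊎-↔_)
open import Data.Product using (Σ; _,_)
open import Data.Product.Function.Dependent.Propositional using (congˡ)
open import Data.Empty using (⊥; ⊥-elim)
open import Function.Bundles using (mk↔ₛ′)
open import Function.Related.Propositional using (bijection)
open import Function.Properties.Inverse using (↔-trans; ↔-sym)
open import Relation.Binary.PropositionalEquality
  using (refl; sym; trans; cong; cong₂; subst; module ≡-Reasoning)
open import Relation.Nullary using (¬_)
open import Relation.Nullary.Decidable using (isYes≗does; dec-true; dec-false)
open import Axiom.UniquenessOfIdentityProofs using (module Decidable⇒UIP)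
import Algebra.Properties.CommutativeSemigroup as CommSemigroupProps
open import Algebra.Bundles using (CommutativeMonoid)

open CommSemigroupProps ℕP.+-commutativeSemigroup
  using () renaming (interchange to +-interchange)
open CommSemigroupProps (CommutativeMonoid.commutativeSemigroup BoolP.∧-commutativeMonoid)
  using () renaming (interchange to ∧-interchange)

true≢false : ¬ (true ≡ false)
true≢false ()

⇒ᵇ-intro : ∀ {a b} → (a ≡ true → b ≡ true) → (a ⇒ᵇ b) ≡ true
⇒ᵇ-intro {true}  h = h refl
⇒ᵇ-intro {false} h = refl

⇒ᵇ-elim : ∀ {a b} → (a ⇒ᵇ b) ≡ true → a ≡ true → b ≡ true
⇒ᵇ-elim h refl = h

⇒ᵇ-refute : ∀ {a b} → a ≡ true → b ≡ false → (a ⇒ᵇ b) ≡ false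
⇒ᵇ-refute refl refl = refl

⇒ᵇ-counterexample : ∀ {a b} → (a ⇒ᵇ b) ≡ false → a ≡ true × b ≡ false
⇒ᵇ-counterexample {true}  h = refl , h
⇒ᵇ-counterexample {false} ()

∨-resolve : ∀ {a b} → a ≡ false → a ∨ b ≡ true → b ≡ true
∨-resolve refl h = h

∨-cases : ∀ a {b} → a ∨ b ≡ true → a ≡ true ⊎ b ≡ true
∨-cases true  _ = inj₁ refl
∨-cases false h = inj₂ h

∨₃-intro : ∀ a b c → (a ≡ false → b ≡ false → c ≡ false → ⊥) → a ∨ (b ∨ c) ≡ true
∨₃-intro true  _     _     _ = refl
∨₃-intro false true  _     _ = refl
∨₃-intro false false true  _ = refl
∨₃-intro false false false h = ⊥-elim (h refl refl refl)

allᵇ-intro : ∀ {n} (p : Fin n → Bool) → (∀ i → p i ≡ true) → allᵇ p ≡ true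
allᵇ-intro {zero}  p h = refl
allᵇ-intro {suc n} p h with p zero | h zero
... | true | refl = allᵇ-intro (λ i → p (suc i)) (λ i → h (suc i))

allᵇ-elim : ∀ {n} (p : Fin n → Bool) → allᵇ p ≡ true → ∀ i → p i ≡ true
allᵇ-elim {suc n} p h zero    with p zero | h
... | true | _ = refl
allᵇ-elim {suc n} p h (suc i) with p zero | h
... | true | h′ = allᵇ-elim (λ j → p (suc j)) h′ i

allᵇ-refute : ∀ {n} (p : Fin n → Bool) i → p i ≡ false → allᵇ p ≡ false
allᵇ-refute {suc n} p zero    e = cong (_∧ allᵇ (λ j → p (suc j))) e
allᵇ-refute {suc n} p (suc i) e =
  trans (cong (p zero ∧_) (allᵇ-refute (λ j → p (suc j)) i e)) (BoolP.∧-zeroʳ (p zero))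

allᵇ-witness : ∀ {n} (p : Fin n → Bool) → allᵇ p ≡ false → Σ (Fin n) λ i → p i ≡ false
allᵇ-witness {suc n} p h with p zero in e
... | false = zero , e
... | true with allᵇ-witness (λ j → p (suc j)) h
...   | i , e′ = suc i , e′

allᵇ-cong : ∀ {n} {p q : Fin n → Bool} → (∀ i → p i ≡ q i) → allᵇ p ≡ allᵇ q
allᵇ-cong {zero}  h = refl
allᵇ-cong {suc n} h = cong₂ _∧_ (h zero) (allᵇ-cong (λ i → h (suc i)))

allᵇ-∧ : ∀ {n} (p q : Fin n → Bool) → allᵇ p ∧ allᵇ q ≡ allᵇ (λ i → p i ∧ q i)
allᵇ-∧ {zero}  p q = refl
allᵇ-∧ {suc n} p q =
  trans (∧-interchange (p zero) _ (q zero) _)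
        (cong ((p zero ∧ q zero) ∧_) (allᵇ-∧ (λ i → p (suc i)) (λ i → q (suc i))))

_⊆ᵇ_ : ∀ {n} → (Fin n → Bool) → (Fin n → Bool) → Bool
f ⊆ᵇ p = allᵇ (λ i → f i ⇒ᵇ p i)

⊆ᵇ-elim : ∀ {n} (f p : Fin n → Bool) {i} → f ⊆ᵇ p ≡ true → f i ≡ true → p i ≡ true
⊆ᵇ-elim f p {i} h = ⇒ᵇ-elim (allᵇ-elim (λ j → f j ⇒ᵇ p j) h i)

⊆ᵇ-witness : ∀ {n} (f p : Fin n → Bool) → f ⊆ᵇ p ≡ false →
  Σ (Fin n) λ i → f i ≡ true × p i ≡ false
⊆ᵇ-witness f p h with allᵇ-witness (λ j → f j ⇒ᵇ p j) h
... | i , e = i , ⇒ᵇ-counterexample e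

⊆ᵇ-∩ : ∀ {n} (f p q : Fin n → Bool) → (f ⊆ᵇ p) ∧ (f ⊆ᵇ q) ≡ f ⊆ᵇ (λ i → p i ∧ q i)
⊆ᵇ-∩ f p q =
  trans (allᵇ-∧ (λ i → f i ⇒ᵇ p i) (λ i → f i ⇒ᵇ q i))
        (allᵇ-cong λ i → sym (BoolP.∨-distribˡ-∧ (not (f i)) (p i) (q i)))

count : ∀ {n} → (Subset n → Bool) → ℕ
count {zero}  p = if p [] then 1 else 0
count {suc n} p = count (λ T → p (false ∷ T)) + count (λ T → p (true ∷ T))

uip-Bool : ∀ {a b : Bool} (x y : a ≡ b) → x ≡ y
uip-Bool = Decidable⇒UIP.≡-irrelevant BoolP._≟_

count-↔ : ∀ {n} (p : Subset n → Bool) → Σ (Subset n) (λ T → p T ≡ true) ↔ Fin (count p)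
count-↔ {zero} p = ↔-trans empty (truth (p []))
  where
  empty : Σ (Subset zero) (λ T → p T ≡ true) ↔ (p [] ≡ true)
  empty = mk↔ₛ′ (λ { ([] , x) → x }) ([] ,_) (λ _ → refl) (λ { ([] , x) → refl })
  truth : (b : Bool) → (b ≡ true) ↔ Fin (if b then 1 else 0)
  truth true  = mk↔ₛ′ (λ _ → zero) (λ _ → refl) (λ { zero → refl }) (λ _ → uip-Bool _ _)
  truth false = mk↔ₛ′ (λ ()) (λ ()) (λ ()) (λ ())
count-↔ {suc n} p = ↔-trans byHead (↔-trans (count-↔ _ ⊎-↔ count-↔ _) (↔-sym FinP.+↔⊎))
  where
  byHead : Σ (Subset (suc n)) (λ T → p T ≡ true) ↔
           (Σ (Subset n) (λ T → p (false ∷ T) ≡ true) ⊎ Σ (Subset n) (λ T → p (true ∷ T) ≡ true))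
  byHead = mk↔ₛ′
    (λ { ((false ∷ T) , x) → inj₁ (T , x) ; ((true ∷ T) , x) → inj₂ (T , x) })
    (λ { (inj₁ (T , x)) → (false ∷ T) , x ; (inj₂ (T , x)) → (true ∷ T) , x })
    (λ { (inj₁ _) → refl ; (inj₂ _) → refl })
    (λ { ((false ∷ _) , _) → refl ; ((true ∷ _) , _) → refl })

count-cong : ∀ {n} {p q : Subset n → Bool} → (∀ T → p T ≡ q T) → count p ≡ count q
count-cong {zero}  h = cong (if_then 1 else 0) (h [])
count-cong {suc n} h =
  cong₂ _+_ (count-cong (λ T → h (false ∷ T))) (count-cong (λ T → h (true ∷ T)))

count-false : ∀ n → count {n} (λ _ → false) ≡ 0
count-false zero    = refl
count-false (suc n) = cong₂ _+_ (count-false n) (count-false n)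

count-true : ∀ n → count {n} (λ _ → true) ≡ 2 ^ n
count-true zero    = refl
count-true (suc n) =
  cong₂ _+_ (count-true n) (trans (count-true n) (sym (ℕP.+-identityʳ (2 ^ n))))

count-snoc : ∀ n (p : Subset (n + 1) → Bool) →
  count p ≡ count (λ T → p (T ++ false ∷ [])) + count (λ T → p (T ++ true ∷ []))
count-snoc zero    p = refl
count-snoc (suc n) p =
  trans (cong₂ _+_ (count-snoc n (λ T → p (false ∷ T))) (count-snoc n (λ T → p (true ∷ T))))
        (+-interchange (c false false) (c false true) (c true false) (c true true))
  where
  c : Bool → Bool → ℕ
  c b b′ = count (λ T → p (b ∷ T ++ b′ ∷ []))

count-∨-∧ : ∀ {n} (p q : Subset n → Bool) →
  count (λ T → p T ∨ q T) + count (λ T → p T ∧ q T) ≡ count p + count q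
count-∨-∧ {zero}  p q = base (p []) (q [])
  where
  base : ∀ a b → (if a ∨ b then 1 else 0) + (if a ∧ b then 1 else 0)
               ≡ (if a then 1 else 0) + (if b then 1 else 0)
  base true  true  = refl
  base true  false = refl
  base false true  = refl
  base false false = refl
count-∨-∧ {suc n} p q = begin
  (∨₀ + ∨₁) + (∧₀ + ∧₁)  ≡⟨ +-interchange ∨₀ ∨₁ ∧₀ ∧₁ ⟩
  (∨₀ + ∧₀) + (∨₁ + ∧₁)  ≡⟨ cong₂ _+_ (count-∨-∧ (λ T → p (false ∷ T)) (λ T → q (false ∷ T)))
                                       (count-∨-∧ (λ T → p (true ∷ T)) (λ T → q (true ∷ T))) ⟩
  (p₀ + q₀) + (p₁ + q₁)  ≡⟨ +-interchange p₀ q₀ p₁ q₁ ⟩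
  (p₀ + p₁) + (q₀ + q₁)  ∎
  where
  open ≡-Reasoning
  ∨₀ = count (λ T → p (false ∷ T) ∨ q (false ∷ T))
  ∨₁ = count (λ T → p (true ∷ T) ∨ q (true ∷ T))
  ∧₀ = count (λ T → p (false ∷ T) ∧ q (false ∷ T))
  ∧₁ = count (λ T → p (true ∷ T) ∧ q (true ∷ T))
  p₀ = count (λ T → p (false ∷ T))
  p₁ = count (λ T → p (true ∷ T))
  q₀ = count (λ T → q (false ∷ T))
  q₁ = count (λ T → q (true ∷ T))

count-⊆ : ∀ {n} (P : Subset n) → count (λ T → lookup T ⊆ᵇ lookup P) ≡ 2 ^ ∣ P ∣
count-⊆ []          = refl
count-⊆ (true ∷ P)  =
  cong₂ _+_ (count-⊆ P) (trans (count-⊆ P) (sym (ℕP.+-identityʳ (2 ^ ∣ P ∣))))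
count-⊆ {suc n} (false ∷ P) =
  trans (cong₂ _+_ (count-⊆ P) (count-false n)) (ℕP.+-identityʳ (2 ^ ∣ P ∣))

count-⊆-∨ : ∀ {n} (P Q : Subset n) →
  count (λ T → lookup T ⊆ᵇ lookup P ∨ lookup T ⊆ᵇ lookup Q) + 2 ^ ∣ P ∩ Q ∣
    ≡ 2 ^ ∣ P ∣ + 2 ^ ∣ Q ∣
count-⊆-∨ {n} P Q = begin
  count (λ T → sub P T ∨ sub Q T) + 2 ^ ∣ P ∩ Q ∣
    ≡⟨ cong (_+_ _) (count-⊆ (P ∩ Q)) ⟨
  count (λ T → sub P T ∨ sub Q T) + count (sub (P ∩ Q))
    ≡⟨ cong (_+_ _) (count-cong intersection) ⟩
  count (λ T → sub P T ∨ sub Q T) + count (λ T → sub P T ∧ sub Q T)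
    ≡⟨ count-∨-∧ (sub P) (sub Q) ⟩
  count (sub P) + count (sub Q)
    ≡⟨ cong₂ _+_ (count-⊆ P) (count-⊆ Q) ⟩
  2 ^ ∣ P ∣ + 2 ^ ∣ Q ∣
    ∎
  where
  open ≡-Reasoning
  sub : Subset n → Subset n → Bool
  sub R T = lookup T ⊆ᵇ lookup R
  intersection : ∀ T → sub (P ∩ Q) T ≡ (sub P T ∧ sub Q T)
  intersection T = trans (allᵇ-cong λ i → cong (lookup T i ⇒ᵇ_) (VecP.lookup-zipWith _∧_ i P Q))
                         (sym (⊆ᵇ-∩ (lookup T) (lookup P) (lookup Q)))

-- The sets contained in P or in its complement; only ∅ lies in both.
count-⊆-or-∁ : ∀ {n} (P : Subset n) →
  count (λ T → lookup T ⊆ᵇ lookup P ∨ lookup T ⊆ᵇ lookup (∁ P)) + 1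
    ≡ 2 ^ ∣ P ∣ + 2 ^ (n ∸ ∣ P ∣)
count-⊆-or-∁ {n} P = begin
  count∨ + 1                       ≡⟨ cong (λ m → count∨ + 2 ^ m) disjoint ⟨
  count∨ + 2 ^ ∣ P ∩ ∁ P ∣         ≡⟨ count-⊆-∨ P (∁ P) ⟩
  2 ^ ∣ P ∣ + 2 ^ ∣ ∁ P ∣          ≡⟨ cong (λ m → 2 ^ ∣ P ∣ + 2 ^ m) (∣∁p∣≡n∸∣p∣ P) ⟩
  2 ^ ∣ P ∣ + 2 ^ (n ∸ ∣ P ∣)      ∎
  where
  open ≡-Reasoning
  count∨ = count (λ T → lookup T ⊆ᵇ lookup P ∨ lookup T ⊆ᵇ lookup (∁ P))
  disjoint : ∣ P ∩ ∁ P ∣ ≡ 0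
  disjoint = trans (cong ∣_∣ (∩-inverseʳ P)) (∣⊥∣≡0 n)

uip-Subset : ∀ {n} {A B : Subset n} (x y : A ≡ B) → x ≡ y
uip-Subset = Decidable⇒UIP.≡-irrelevant (VecP.≡-dec BoolP._≟_)

prop-↔ : ∀ {P Q : Set} → (∀ (x y : P) → x ≡ y) → (∀ (x y : Q) → x ≡ y) →
  (P → Q) → (Q → P) → P ↔ Q
prop-↔ irrP irrQ f g = mk↔ₛ′ f g (λ _ → irrQ _ _) (λ _ → irrP _ _)

module FormalContext (C : Context) where
  open Context C

  Closed : Subset nG → Set
  Closed A = extent C (intent C A) ≡ A

  concept↔closed : Concept C ↔ Σ (Subset nG) Closed
  concept↔closed = mk↔ₛ′ to from (λ _ → refl) from∘to
    where
    to : Concept C → Σ (Subset nG) Closed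
    to ((A , B) , A′≡B , B′≡A) = A , trans (cong (extent C) A′≡B) B′≡A
    from : Σ (Subset nG) Closed → Concept C
    from (A , closed) = (A , intent C A) , refl , closed
    from∘to : ∀ c → from (to c) ≡ c
    from∘to ((A , B) , refl , _) = refl

  concepts-counted : (p : Subset nG → Bool) →
    (∀ A → p A ≡ true → Closed A) → (∀ A → Closed A → p A ≡ true) →
    Concept C ↔ Fin (count p)
  concepts-counted p sound complete =
    ↔-trans concept↔closed
      (↔-trans (congˡ {k = bijection} (prop-↔ uip-Subset uip-Bool (complete _) (sound _))) (count-↔ p))

  intent-intro : ∀ A m → (∀ g → lookup A g ≡ true → inc g m ≡ true) →
    lookup (intent C A) m ≡ true
  intent-intro A m h = trans (VecP.lookup∘tabulate _ m) (allᵇ-intro _ λ g → ⇒ᵇ-intro (h g))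

  intent-elim : ∀ A m g → lookup (intent C A) m ≡ true → lookup A g ≡ true → inc g m ≡ true
  intent-elim A m g m∈A′ =
    ⇒ᵇ-elim (allᵇ-elim _ (trans (sym (VecP.lookup∘tabulate _ m)) m∈A′) g)

  closed-if-separated : ∀ A →
    (∀ g → lookup A g ≡ false → Σ (Fin nM) λ m → lookup (intent C A) m ≡ true × inc g m ≡ false) →
    Closed A
  closed-if-separated A separate = trans (VecP.tabulate-cong pointwise) (VecP.tabulate∘lookup A)
    where
    pointwise : ∀ g → allᵇ (λ m → lookup (intent C A) m ⇒ᵇ inc g m) ≡ lookup A g
    pointwise g with lookup A g in g∈?
    ... | true  = allᵇ-intro _ λ m → ⇒ᵇ-intro λ m∈A′ → intent-elim A m g m∈A′ g∈?
    ... | false with separate g g∈?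
    ...   | m , m∈A′ , ¬gIm = allᵇ-refute _ m (⇒ᵇ-refute m∈A′ ¬gIm)

  closed-contains : ∀ A g → Closed A → (∀ m → lookup (intent C A) m ≡ true → inc g m ≡ true) →
    lookup A g ≡ true
  closed-contains A g closed h =
    trans (cong (λ X → lookup X g) (sym closed))
          (trans (VecP.lookup∘tabulate _ g) (allᵇ-intro _ λ m → ⇒ᵇ-intro (h m)))

data SplitView (n m : ℕ) : Fin (n + m) → Set where
  left  : (i : Fin n) → SplitView n m (i ↑ˡ m)
  right : (x : Fin m) → SplitView n m (n ↑ʳ x)

splitView : ∀ n {m} (g : Fin (n + m)) → SplitView n m g
splitView n {m} g = view (splitAt n g) (FinP.join-splitAt n m g)
  where
  view : (s : Fin n ⊎ Fin m) → join n m s ≡ g → SplitView n m g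
  view (inj₁ i) refl = left i
  view (inj₂ x) refl = right x

neq-irrefl : ∀ {n} (i : Fin n) → neq i i ≡ false
neq-irrefl i = cong not (trans (isYes≗does (i Fin.≟ i)) (dec-true (i Fin.≟ i) refl))

neq-distinct : ∀ {n} {i j : Fin n} → ¬ (i ≡ j) → neq i j ≡ true
neq-distinct {i = i} {j} i≢j = cong not (trans (isYes≗does (i Fin.≟ j)) (dec-false (i Fin.≟ j) i≢j))

-- Objects: i ↑ˡ 1 is i ∈ S_n and
-- n ↑ʳ zero is g₁.  Attributes of K^k_n: j ↑ˡ 2 is j ∈ S_n and n ↑ʳ x is
-- m₁ (x = zero) or m₂ (x = suc zero); of K^k_nge: j ↑ˡ 1 and m₁₂ = n ↑ʳ zero.
module Incidence (n k : ℕ) where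
  I = I-rel n k
  J = J-rel n k

  -- block x is the set of objects of S_n having attribute m_x.
  block : Fin 2 → Fin n → Bool
  block zero       i = inLow k i
  block (suc zero) i = not (inLow k i)

  I-SS : ∀ i j → I (i ↑ˡ 1) (j ↑ˡ 2) ≡ neq i j
  I-SS i j rewrite FinP.splitAt-↑ˡ n i 1 | FinP.splitAt-↑ˡ n j 2 = refl

  I-g₁S : ∀ j → I (n ↑ʳ zero) (j ↑ˡ 2) ≡ true
  I-g₁S j rewrite FinP.splitAt-↑ʳ n 1 zero | FinP.splitAt-↑ˡ n j 2 = refl

  I-g₁m : ∀ x → I (n ↑ʳ zero) (n ↑ʳ x) ≡ false
  I-g₁m x rewrite FinP.splitAt-↑ʳ n 1 zero | FinP.splitAt-↑ʳ n 2 x = refl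

  I-Sm : ∀ x i → I (i ↑ˡ 1) (n ↑ʳ x) ≡ block x i
  I-Sm zero       i rewrite FinP.splitAt-↑ˡ n i 1 | FinP.splitAt-↑ʳ n 2 zero = refl
  I-Sm (suc zero) i rewrite FinP.splitAt-↑ˡ n i 1 | FinP.splitAt-↑ʳ n 2 (suc zero) = refl

  J-S : ∀ g j → J g (j ↑ˡ 1) ≡ I g (j ↑ˡ 2)
  J-S g j rewrite FinP.splitAt-↑ˡ n j 1 = refl

  J-m₁₂ : ∀ g → J g (n ↑ʳ zero) ≡ I g (n ↑ʳ zero) ∨ I g (n ↑ʳ suc zero)
  J-m₁₂ g rewrite FinP.splitAt-↑ʳ n 1 zero = refl

  -- If i ∉ A, every object of A has attribute i: the elements of S_n in A
  -- differ from i, and g₁ has all attributes of S_n.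
  missing-attribute : ∀ (A : Subset (n + 1)) i → lookup A (i ↑ˡ 1) ≡ false →
    ∀ g → lookup A g ≡ true → I g (i ↑ˡ 2) ≡ true
  missing-attribute A i i∉A g g∈A with splitView n g
  ... | left j       = trans (I-SS j i) (neq-distinct λ { refl → true≢false (trans (sym g∈A) i∉A) })
  ... | right zero   = I-g₁S i

module ContextK (n k : ℕ) where
  open Incidence n k
  open FormalContext (K n k)

  g₁ : Fin (n + 1)
  g₁ = n ↑ʳ zero

  inS : Subset (n + 1) → Fin n → Bool
  inS A i = lookup A (i ↑ˡ 1)

  closedᵇ : Subset (n + 1) → Bool
  closedᵇ A = lookup A g₁ ∨ (inS A ⊆ᵇ block zero ∨ inS A ⊆ᵇ block (suc zero))

  block-attribute : ∀ A x → lookup A g₁ ≡ false → inS A ⊆ᵇ block x ≡ true →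
    lookup (intent (K n k) A) (n ↑ʳ x) ≡ true
  block-attribute A x g₁∉A A⊆block = intent-intro A (n ↑ʳ x) common
    where
    common : ∀ g → lookup A g ≡ true → I g (n ↑ʳ x) ≡ true
    common g g∈A with splitView n g
    ... | left i     = trans (I-Sm x i) (⊆ᵇ-elim (inS A) (block x) A⊆block g∈A)
    ... | right zero = ⊥-elim (true≢false (trans (sym g∈A) g₁∉A))

  block-attribute-excluded : ∀ A x → inS A ⊆ᵇ block x ≡ false →
    ¬ (lookup (intent (K n k) A) (n ↑ʳ x) ≡ true)
  block-attribute-excluded A x A⊈block mₓ∈A′ with ⊆ᵇ-witness (inS A) (block x) A⊈block
  ... | i , i∈A , i∉block =
    true≢false (trans (sym (intent-elim A (n ↑ʳ x) (i ↑ˡ 1) mₓ∈A′ i∈A))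
                      (trans (I-Sm x i) i∉block))

  closedᵇ-sound : ∀ A → closedᵇ A ≡ true → Closed A
  closedᵇ-sound A h = closed-if-separated A separate
    where
    separate : ∀ g → lookup A g ≡ false →
      Σ (Fin (n + 2)) λ m → lookup (intent (K n k) A) m ≡ true × I g m ≡ false
    separate g g∉A with splitView n g
    ... | left i     = i ↑ˡ 2 , intent-intro A _ (missing-attribute A i g∉A) ,
                       trans (I-SS i i) (neq-irrefl i)
    ... | right zero with ∨-cases (inS A ⊆ᵇ block zero) (∨-resolve g∉A h)
    ...   | inj₁ low  = n ↑ʳ zero , block-attribute A zero g∉A low , I-g₁m zero
    ...   | inj₂ high = n ↑ʳ suc zero , block-attribute A (suc zero) g∉A high , I-g₁m (suc zero)

  -- If g₁ ∉ A and A meets both blocks, then neither m₁ nor m₂ is common to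
  -- A, so g₁ has all attributes of A′ and A is not closed.
  closedᵇ-complete : ∀ A → Closed A → closedᵇ A ≡ true
  closedᵇ-complete A closed = ∨₃-intro _ _ _ λ g₁∉A meets₁ meets₂ →
    true≢false (trans (sym (closed-contains A g₁ closed (g₁-has meets₁ meets₂))) g₁∉A)
    where
    g₁-has : inS A ⊆ᵇ block zero ≡ false → inS A ⊆ᵇ block (suc zero) ≡ false →
      ∀ m → lookup (intent (K n k) A) m ≡ true → I g₁ m ≡ true
    g₁-has meets₁ meets₂ m m∈A′ with splitView n m
    ... | left j           = I-g₁S j
    ... | right zero       = ⊥-elim (block-attribute-excluded A zero meets₁ m∈A′)
    ... | right (suc zero) = ⊥-elim (block-attribute-excluded A (suc zero) meets₂ m∈A′)

  concepts : Concept (K n k) ↔ Fin (count closedᵇ)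
  concepts = concepts-counted closedᵇ closedᵇ-sound closedᵇ-complete

module ContextKge (n k : ℕ) where
  open Incidence n k
  open FormalContext (Kge n k)

  -- Every set of objects is closed: g₁ is separated by m₁₂, which every
  -- element of S_n has.
  all-closed : ∀ A → Closed A
  all-closed A = closed-if-separated A separate
    where
    separate : ∀ g → lookup A g ≡ false →
      Σ (Fin (n + 1)) λ m → lookup (intent (Kge n k) A) m ≡ true × J g m ≡ false
    separate g g∉A with splitView n g
    ... | left i     =
      i ↑ˡ 1 ,
      intent-intro A _ (λ g′ g′∈A → trans (J-S g′ i) (missing-attribute A i g∉A g′ g′∈A)) ,
      trans (J-S g i) (trans (I-SS i i) (neq-irrefl i))
    ... | right zero =
      n ↑ʳ zero ,
      intent-intro A _ common ,
      trans (J-m₁₂ g) (cong₂ _∨_ (I-g₁m zero) (I-g₁m (suc zero)))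
      where
      common : ∀ g′ → lookup A g′ ≡ true → J g′ (n ↑ʳ zero) ≡ true
      common g′ g′∈A with splitView n g′
      ... | left j     = trans (J-m₁₂ _) (trans (cong₂ _∨_ (I-Sm zero j) (I-Sm (suc zero) j))
                                                (BoolP.∨-inverseʳ (inLow k j)))
      ... | right zero = ⊥-elim (true≢false (trans (sym g′∈A) g∉A))

  concepts : Concept (Kge n k) ↔ Fin (count {n + 1} (λ _ → true))
  concepts = concepts-counted (λ _ → true) (λ A _ → all-closed A) (λ _ _ → refl)

Low : (n k : ℕ) → Subset n
Low n k = tabulate (inLow k)

∣Low∣ : ∀ {n k} → k ≤ n → ∣ Low n k ∣ ≡ k
∣Low∣ {zero}  z≤n     = refl
∣Low∣ {suc n} z≤n     = ∣Low∣ {n} z≤n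
∣Low∣ {suc n} (s≤s h) = cong suc (∣Low∣ h)

-- Closed sets of K^k_n: 2^n contain g₁, and 2^(n-k) + 2^k - 1 do not.
count-closedK : ∀ n k → k ≤ n → count (ContextK.closedᵇ n k) + 1 ≡ 2 ^ n + 2 ^ (n ∸ k) + 2 ^ k
count-closedK n k k≤n = begin
  count closedᵇ + 1                        ≡⟨ cong (_+ 1) count-by-g₁ ⟩
  (lowOrHigh + 2 ^ n) + 1                  ≡⟨ rearrange lowOrHigh (2 ^ n) ⟩
  2 ^ n + (lowOrHigh + 1)                  ≡⟨ cong (_+_ (2 ^ n)) (count-⊆-or-∁ L) ⟩
  2 ^ n + (2 ^ ∣ L ∣ + 2 ^ (n ∸ ∣ L ∣))    ≡⟨ cong (λ l → 2 ^ n + (2 ^ l + 2 ^ (n ∸ l))) (∣Low∣ k≤n) ⟩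
  2 ^ n + (2 ^ k + 2 ^ (n ∸ k))            ≡⟨ cong (_+_ (2 ^ n)) (ℕP.+-comm (2 ^ k) (2 ^ (n ∸ k))) ⟩
  2 ^ n + (2 ^ (n ∸ k) + 2 ^ k)            ≡⟨ ℕP.+-assoc (2 ^ n) (2 ^ (n ∸ k)) (2 ^ k) ⟨
  2 ^ n + 2 ^ (n ∸ k) + 2 ^ k              ∎
  where
  open ≡-Reasoning
  open ContextK n k using (closedᵇ)
  L = Low n k
  lowOrHigh = count (λ T → lookup T ⊆ᵇ lookup L ∨ lookup T ⊆ᵇ lookup (∁ L))
  -- on the objects of S_n, the blocks are L and its complement
  snoc : ∀ T b → closedᵇ (T ++ b ∷ []) ≡ b ∨ (lookup T ⊆ᵇ lookup L ∨ lookup T ⊆ᵇ lookup (∁ L))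
  snoc T b = cong₂ _∨_ (VecP.lookup-++ʳ T (b ∷ []) zero) (cong₂ _∨_
    (allᵇ-cong λ i → cong₂ _⇒ᵇ_ (VecP.lookup-++ˡ T _ i) (sym (VecP.lookup∘tabulate (inLow k) i)))
    (allᵇ-cong λ i → cong₂ _⇒ᵇ_ (VecP.lookup-++ˡ T _ i)
       (sym (trans (VecP.lookup-map i not L) (cong not (VecP.lookup∘tabulate (inLow k) i))))))
  -- split on whether g₁, the last object, belongs to the set
  count-by-g₁ : count closedᵇ ≡ lowOrHigh + 2 ^ n
  count-by-g₁ = trans (count-snoc n closedᵇ)
    (cong₂ _+_ (count-cong (λ T → snoc T false))
               (trans (count-cong (λ T → snoc T true)) (count-true n)))
  rearrange : ∀ c a → (c + a) + 1 ≡ a + (c + 1)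
  rearrange = solve 2 (λ c a → (c :+ a) :+ con 1 := a :+ (c :+ con 1)) refl
    where open +-*-Solver

-- The integer identity behind part (b): with M = 2·2^n and
-- N + 1 = 2^n + 2^(n-k) + 2^k, M - N = 2^n - 2^k - 2^(n-k) + 1.
difference : ∀ a b c M N → M ≡ a + a → N + 1 ≡ a + c + b →
  (+ M) -ℤ (+ N) ≡ (+ a) -ℤ (+ b) -ℤ (+ c) +ℤ (+ 1)
difference a b c M N refl N+1≡ = begin
  + (a + a) -ℤ + N                                   ≡⟨ cong₂ _-ℤ_ (pos-+ a a) N≡ ⟩
  (+ a +ℤ + a) -ℤ ((+ a +ℤ + c +ℤ + b) -ℤ + 1)       ≡⟨ simplify (+ a) (+ b) (+ c) ⟩
  (+ a) -ℤ (+ b) -ℤ (+ c) +ℤ (+ 1)                   ∎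
  where
  open ≡-Reasoning
  open ℤSolver.+-*-Solver
  simplify : ∀ A B C → (A +ℤ A) -ℤ ((A +ℤ C +ℤ B) -ℤ + 1) ≡ A -ℤ B -ℤ C +ℤ + 1
  simplify = solve 3 (λ A B C → (A :+ A) :- ((A :+ C :+ B) :- con (+ 1))
                             := A :- B :- C :+ con (+ 1)) refl
  N≡ : + N ≡ (+ a +ℤ + c +ℤ + b) -ℤ + 1
  N≡ = begin
    + N                             ≡⟨ solve 1 (λ X → X := (X :+ con (+ 1)) :- con (+ 1)) refl (+ N) ⟩
    (+ N +ℤ + 1) -ℤ + 1             ≡⟨ cong (_-ℤ + 1) (sym (pos-+ N 1)) ⟩
    + (N + 1) -ℤ + 1                ≡⟨ cong (λ x → + x -ℤ + 1) N+1≡ ⟩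
    + (a + c + b) -ℤ + 1            ≡⟨ cong (_-ℤ + 1) (trans (pos-+ (a + c) b)
                                                        (cong (_+ℤ + b) (pos-+ a c))) ⟩
    (+ a +ℤ + c +ℤ + b) -ℤ + 1      ∎

proposition5 : (n k : ℕ) → 2 ≤ n → 1 ≤ k → k < n →
    (Concept (K n k) ↔ Fin (2 ^ n + 2 ^ (n ∸ k) + 2 ^ k ∸ 1))
    × ((N M : ℕ) → Concept (K n k) ↔ Fin N → Concept (Kge n k) ↔ Fin M →
       (+ M) -ℤ (+ N) ≡ (+ (2 ^ n)) -ℤ (+ (2 ^ k)) -ℤ (+ (2 ^ (n ∸ k))) +ℤ (+ 1))
proposition5 n k _ _ k<n = partA , partB
  where
  k≤n : k ≤ n
  k≤n = ℕP.<⇒≤ k<n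
  #closedK : count (ContextK.closedᵇ n k) ≡ 2 ^ n + 2 ^ (n ∸ k) + 2 ^ k ∸ 1
  #closedK = trans (sym (ℕP.m+n∸n≡m _ 1)) (cong (_∸ 1) (count-closedK n k k≤n))
  partA : Concept (K n k) ↔ Fin (2 ^ n + 2 ^ (n ∸ k) + 2 ^ k ∸ 1)
  partA = subst (λ N → Concept (K n k) ↔ Fin N) #closedK (ContextK.concepts n k)
  partB : (N M : ℕ) → Concept (K n k) ↔ Fin N → Concept (Kge n k) ↔ Fin M →
    (+ M) -ℤ (+ N) ≡ (+ (2 ^ n)) -ℤ (+ (2 ^ k)) -ℤ (+ (2 ^ (n ∸ k))) +ℤ (+ 1)
  partB N M K↔N Kge↔M = difference (2 ^ n) (2 ^ k) (2 ^ (n ∸ k)) M N M≡ N+1≡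
    where
    N+1≡ : N + 1 ≡ 2 ^ n + 2 ^ (n ∸ k) + 2 ^ k
    N+1≡ = trans (cong (_+ 1) (↔⇒≡ (↔-trans (↔-sym K↔N) (ContextK.concepts n k))))
                 (count-closedK n k k≤n)
    -- every one of the 2^(n+1) sets of objects of K^k_nge is an extent
    M≡ : M ≡ 2 ^ n + 2 ^ n
    M≡ = trans (↔⇒≡ (↔-trans (↔-sym Kge↔M) (ContextKge.concepts n k)))
               (trans (count-snoc n (λ _ → true)) (cong₂ _+_ (count-true n) (count-true n)))
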